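{- Let $g=\begin{pmatrix}a&b\\c&d\end{pmatrix}\in G$ with $gg^*=n(g)1_2$. Then the principal polynomial $\Phi(x)$ of $g$ is $$\Phi(x)=x^4-(\mathrm{Tr}(a)+\mathrm{Tr}(d))x^3+\bigl(\mathrm{Tr}(a)\mathrm{Tr}(d)-N(b+\overline c)+2n(g)\bigr)x^2-(\mathrm{Tr}(a)+\mathrm{Tr}(d))n(g)x+n(g)^2,$$ and equivalently $$\Phi(x)=x^4-\mathrm{Tr}(g)x^3+\tfrac12\bigl(\mathrm{Tr}(g)^2-\mathrm{Tr}(g^2)\bigr)x^2-\mathrm{Tr}(g)n(g)x+n(g)^2.$$
   Context: $B$ is a definite quaternion algebra over $\mathbb{Q}$ with main involution $x\mapsto\overline x$, reduced trace $\mathrm{Tr}$ and reduced norm $N$. For $g=(g_{ij})\in M_2(B)$, $g^*=(\overline{g_{ji}})$ and $G=\{g\in M_2(B): gg^*=n(g)1_2,\ n(g)\in\mathbb{Q}^\times_{>0}\}$. For $g\in M_2(B)$, $\mathrm{Tr}(g)$ denotes the sum of the reduced traces of its diagonal entries (equivalently the trace of $g$ as a $4\times4$ complex matrix). The principal polynomial of $g$ is its characteristic polynomial under $M_2(B)\subset M_2(B\otimes\mathbb{R})\subset M_4(\mathbb{C})$. -}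

module Defs where

open import Data.Nat using (ℕ; zero; suc)
open import Data.Fin using (Fin; zero; suc; punchIn)
open import Data.List using (List; []; _∷_)
open import Data.Product using (_×_; _,_)
open import Data.Rational using (ℚ; 0ℚ; 1ℚ; _+_; _*_; -_; _-_; _<_)
open import Relation.Binary.PropositionalEquality using (_≡_)
open import Relation.Nullary using (Dec; yes; no)
open import Data.Fin.Properties using () renaming (_≟_ to _≟F_)

-- Quaternion algebra B = (α, β)_ℚ : basis 1, i, j, k = ij with
-- i² = α, j² = β, ij = -ji.  Every quaternion algebra over ℚ is of this
-- form; it is definite (B ⊗ ℝ ≅ Hamilton quaternions) iff α < 0 and β < 0.

record Quat : Set where
  constructor quat
  field
    q0 q1 q2 q3 : ℚ
open Quat public

module QuatAlg (α β : ℚ) where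

  infixl 6 _+Q_ _+K_ _+P_
  infixl 7 _*Q_ _*K_ _*P_ _*M_

  _+Q_ : Quat → Quat → Quat
  quat a0 a1 a2 a3 +Q quat b0 b1 b2 b3 = quat (a0 + b0) (a1 + b1) (a2 + b2) (a3 + b3)

  _*Q_ : Quat → Quat → Quat
  quat a0 a1 a2 a3 *Q quat b0 b1 b2 b3 = quat
    (a0 * b0 + α * (a1 * b1) + β * (a2 * b2) - α * β * (a3 * b3))
    (a0 * b1 + a1 * b0 - β * (a2 * b3) + β * (a3 * b2))
    (a0 * b2 + a2 * b0 + α * (a1 * b3) - α * (a3 * b1))
    (a0 * b3 + a3 * b0 + a1 * b2 - a2 * b1)

  conj : Quat → Quat
  conj (quat a0 a1 a2 a3) = quat a0 (- a1) (- a2) (- a3)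

  scalarQ : ℚ → Quat
  scalarQ r = quat r 0ℚ 0ℚ 0ℚ

  -- reduced trace Tr(x) = x + x̄ and reduced norm N(x) = x x̄
  Trd : Quat → ℚ
  Trd (quat a0 a1 a2 a3) = a0 + a0

  Nrd : Quat → ℚ
  Nrd (quat a0 a1 a2 a3) = a0 * a0 - α * (a1 * a1) - β * (a2 * a2) + α * β * (a3 * a3)

  record M2 : Set where
    constructor mat
    field
      ea eb ec ed : Quat   -- g = (a b ; c d)
  open M2 public

  _*M_ : M2 → M2 → M2
  mat a b c d *M mat a' b' c' d' =
    mat (a *Q a' +Q b *Q c') (a *Q b' +Q b *Q d')
        (c *Q a' +Q d *Q c') (c *Q b' +Q d *Q d')

  star : M2 → M2
  star (mat a b c d) = mat (conj a) (conj c) (conj b) (conj d)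

  scalarM : ℚ → M2
  scalarM r = mat (scalarQ r) (scalarQ 0ℚ) (scalarQ 0ℚ) (scalarQ r)

  TrM : M2 → ℚ
  TrM (mat a b c d) = Trd a + Trd d

  -- K = ℚ(√α) ⊂ ℂ (α < 0), elements x + y·s with s² = α.
  K : Set
  K = ℚ × ℚ

  0K 1K : K
  0K = 0ℚ , 0ℚ
  1K = 1ℚ , 0ℚ

  ofℚ : ℚ → K
  ofℚ r = r , 0ℚ

  _+K_ : K → K → K
  (x , y) +K (x' , y') = (x + x') , (y + y')

  _*K_ : K → K → K
  (x , y) *K (x' , y') = (x * x' + α * (y * y')) , (x * y' + y * x')

  -K_ : K → K
  -K (x , y) = (- x) , (- y)

  -- B ⊗ ℝ ⊂ M₂(ℂ) via  i ↦ (s 0 ; 0 -s),  j ↦ (0 β ; 1 0),  k = ij.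
  -- q ↦ ( q0 + q1 s     β q2 + β q3 s ;  q2 - q3 s    q0 - q1 s )
  embQ : Quat → Fin 2 → Fin 2 → K
  embQ (quat a0 a1 a2 a3) zero       zero       = a0 , a1
  embQ (quat a0 a1 a2 a3) zero       (suc zero) = (β * a2) , (β * a3)
  embQ (quat a0 a1 a2 a3) (suc zero) zero       = a2 , (- a3)
  embQ (quat a0 a1 a2 a3) (suc zero) (suc zero) = a0 , (- a1)

  embM : M2 → Fin 4 → Fin 4 → K
  embM g i j = blk (half i) (half j) (low i) (low j)
    where
    half : Fin 4 → Fin 2
    half zero = zero
    half (suc zero) = zero
    half (suc (suc _)) = suc zero
    low : Fin 4 → Fin 2
    low zero = zero
    low (suc zero) = suc zero
    low (suc (suc zero)) = zero
    low (suc (suc (suc _))) = suc zero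
    blk : Fin 2 → Fin 2 → Fin 2 → Fin 2 → K
    blk zero       zero       = embQ (ea g)
    blk zero       (suc zero) = embQ (eb g)
    blk (suc zero) zero       = embQ (ec g)
    blk (suc zero) (suc zero) = embQ (ed g)

  -- Polynomials over K as coefficient lists (constant term first).
  Poly : Set
  Poly = List K

  _+P_ : Poly → Poly → Poly
  [] +P q = q
  (a ∷ p) +P [] = a ∷ p
  (a ∷ p) +P (b ∷ q) = (a +K b) ∷ (p +P q)

  scaleP : K → Poly → Poly
  scaleP c [] = []
  scaleP c (a ∷ p) = (c *K a) ∷ scaleP c p

  _*P_ : Poly → Poly → Poly
  [] *P q = []
  (a ∷ p) *P q = scaleP a q +P (0K ∷ (p *P q))

  -P_ : Poly → Poly
  -P p = scaleP (-K 1K) p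

  coeff : Poly → ℕ → K
  coeff [] _ = 0K
  coeff (a ∷ p) zero = a
  coeff (a ∷ p) (suc k) = coeff p k

  _≈P_ : Poly → Poly → Set
  p ≈P q = ∀ k → coeff p k ≡ coeff q k

  det : ∀ n → (Fin n → Fin n → Poly) → Poly
  det zero M = 1K ∷ []
  det (suc n) M = go n (λ j → j) 1K
    where
    minor : Fin (suc n) → Fin n → Fin n → Poly
    minor j r c = M (suc r) (punchIn j c)
    term : Fin (suc n) → K → Poly
    term j sgn = scaleP sgn (M zero j *P det n (minor j))
    go : (m : ℕ) → (Fin (suc m) → Fin (suc n)) → K → Poly
    go zero f sgn = term (f zero) sgn
    go (suc m) f sgn = term (f zero) sgn +P go m (λ k → f (suc k)) (-K sgn)

  charPoly : ∀ n → (Fin n → Fin n → K) → Poly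
  charPoly n M = det n (λ i j → entry i j (i ≟F j))
    where
    entry : (i j : Fin n) → Dec (i ≡ j) → Poly
    entry i j (yes _) = (-K M i j) ∷ 1K ∷ []
    entry i j (no _)  = (-K M i j) ∷ []

  principalPoly : M2 → Poly
  principalPoly g = charPoly 4 (embM g)

  ratPoly : List ℚ → Poly
  ratPoly [] = []
  ratPoly (r ∷ rs) = ofℚ r ∷ ratPoly rs

{-# OPTIONS --safe #-}
module Submission where

-- Write h = g g*.  As polynomials in α, β and the coordinates of a, b, c, d, the coefficients
-- Φᵢ of xⁱ in the principal polynomial satisfy, with no hypothesis on g,
--   Φ₀ = h₁₁⁰ h₂₂⁰ − N(h₁₂),
--   Φ₁ = −(Tr(a) h₂₂⁰ + Tr(d) h₁₁⁰ − Tr(h₂₁ c̄) − Tr(h₁₂ b̄)),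
--   Φ₂ = Tr(a) Tr(d) − N(b + c̄) + h₁₁⁰ + h₂₂⁰ = ½ (Tr(g)² − Tr(g²)),
--   Φ₃ = −Tr(g),   Φ₄ = 1,
-- where x⁰ is the scalar part of x.  Φ₀ is the reduced norm N(a)N(d) + N(b)N(c) − Tr(a c̄ d b̄)
-- of g, and −Φ₁ the trace of its adjugate, rewritten through the entries of h.  Each identity
-- is decided by ring normalisation, and substituting h = n·1₂ gives the theorem.

open import Defs
open import Data.List using (List; []; _∷_)
open import Data.Product using (_×_; _,_; proj₁; proj₂)
open import Data.Rational using (ℚ; 0ℚ; 1ℚ; ½; _+_; _*_; -_; _-_; _<_)
open import Data.Rational.Properties using (+-*-commutativeRing; _≟_)
open import Data.Nat as ℕ using (ℕ; zero; suc)
open import Data.Fin using (Fin; zero; suc; punchIn; #_)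
open import Data.Fin.Properties using () renaming (_≟_ to _≟F_)
open import Data.Vec using (Vec; []; _∷_)
open import Level using (0ℓ)
open import Relation.Binary.PropositionalEquality using (_≡_; refl; sym; trans; cong; cong₂; subst)
open import Relation.Nullary using (Dec; yes; no)
open import Relation.Nullary.Decidable using (dec⇒maybe)
open import Tactic.RingSolver.Core.AlmostCommutativeRing using (AlmostCommutativeRing; fromCommutativeRing)

ℚ-ring : AlmostCommutativeRing 0ℓ 0ℓ
ℚ-ring = fromCommutativeRing +-*-commutativeRing (λ x → dec⇒maybe (0ℚ ≟ x))

open import Tactic.RingSolver.NonReflective ℚ-ring using (module Ops; Expr; Κ; Ι; _⊕_; _⊗_; ⊝_)
open Ops using (⟦_⟧; ⟦_⇓⟧; prove)

-- QuatAlg and the Φᵢ of PrincipalPolynomial below, transcribed over ring-solver expressions: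
-- ⟦_⟧ sends each operation here to its namesake over ℚ definitionally, so identities between
-- the latter follow by `prove` from equal normal forms.
module Reified {m : ℕ} (α β : Expr ℚ m) where

  infixl 6 _+Q_ _+K_ _+P_ _⊖_
  infixl 7 _*Q_ _*K_ _*P_ _*M_

  _⊖_ : Expr ℚ m → Expr ℚ m → Expr ℚ m
  x ⊖ y = x ⊕ (⊝ y)

  record Quatᴱ : Set where
    constructor quatᴱ
    field
      q0ᴱ q1ᴱ q2ᴱ q3ᴱ : Expr ℚ m
  open Quatᴱ public

  _+Q_ : Quatᴱ → Quatᴱ → Quatᴱ
  quatᴱ a0 a1 a2 a3 +Q quatᴱ b0 b1 b2 b3 = quatᴱ (a0 ⊕ b0) (a1 ⊕ b1) (a2 ⊕ b2) (a3 ⊕ b3)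

  _*Q_ : Quatᴱ → Quatᴱ → Quatᴱ
  quatᴱ a0 a1 a2 a3 *Q quatᴱ b0 b1 b2 b3 = quatᴱ
    (a0 ⊗ b0 ⊕ α ⊗ (a1 ⊗ b1) ⊕ β ⊗ (a2 ⊗ b2) ⊖ α ⊗ β ⊗ (a3 ⊗ b3))
    (a0 ⊗ b1 ⊕ a1 ⊗ b0 ⊖ β ⊗ (a2 ⊗ b3) ⊕ β ⊗ (a3 ⊗ b2))
    (a0 ⊗ b2 ⊕ a2 ⊗ b0 ⊕ α ⊗ (a1 ⊗ b3) ⊖ α ⊗ (a3 ⊗ b1))
    (a0 ⊗ b3 ⊕ a3 ⊗ b0 ⊕ a1 ⊗ b2 ⊖ a2 ⊗ b1)

  conj : Quatᴱ → Quatᴱ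
  conj (quatᴱ a0 a1 a2 a3) = quatᴱ a0 (⊝ a1) (⊝ a2) (⊝ a3)

  scalarQ : Expr ℚ m → Quatᴱ
  scalarQ r = quatᴱ r (Κ 0ℚ) (Κ 0ℚ) (Κ 0ℚ)

  Trd : Quatᴱ → Expr ℚ m
  Trd (quatᴱ a0 a1 a2 a3) = a0 ⊕ a0

  Nrd : Quatᴱ → Expr ℚ m
  Nrd (quatᴱ a0 a1 a2 a3) = a0 ⊗ a0 ⊖ α ⊗ (a1 ⊗ a1) ⊖ β ⊗ (a2 ⊗ a2) ⊕ α ⊗ β ⊗ (a3 ⊗ a3)

  record M2 : Set where
    constructor mat
    field
      ea eb ec ed : Quatᴱ
  open M2 public

  _*M_ : M2 → M2 → M2
  mat a b c d *M mat a' b' c' d' =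
    mat (a *Q a' +Q b *Q c') (a *Q b' +Q b *Q d')
        (c *Q a' +Q d *Q c') (c *Q b' +Q d *Q d')

  star : M2 → M2
  star (mat a b c d) = mat (conj a) (conj c) (conj b) (conj d)

  scalarM : Expr ℚ m → M2
  scalarM r = mat (scalarQ r) (scalarQ (Κ 0ℚ)) (scalarQ (Κ 0ℚ)) (scalarQ r)

  TrM : M2 → Expr ℚ m
  TrM (mat a b c d) = Trd a ⊕ Trd d

  K : Set
  K = Expr ℚ m × Expr ℚ m

  0K 1K : K
  0K = Κ 0ℚ , Κ 0ℚ
  1K = Κ 1ℚ , Κ 0ℚ

  _+K_ : K → K → K
  (x , y) +K (x' , y') = (x ⊕ x') , (y ⊕ y')

  _*K_ : K → K → K
  (x , y) *K (x' , y') = (x ⊗ x' ⊕ α ⊗ (y ⊗ y')) , (x ⊗ y' ⊕ y ⊗ x')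

  -K_ : K → K
  -K (x , y) = (⊝ x) , (⊝ y)

  embQ : Quatᴱ → Fin 2 → Fin 2 → K
  embQ (quatᴱ a0 a1 a2 a3) zero       zero       = a0 , a1
  embQ (quatᴱ a0 a1 a2 a3) zero       (suc zero) = (β ⊗ a2) , (β ⊗ a3)
  embQ (quatᴱ a0 a1 a2 a3) (suc zero) zero       = a2 , (⊝ a3)
  embQ (quatᴱ a0 a1 a2 a3) (suc zero) (suc zero) = a0 , (⊝ a1)

  embM : M2 → Fin 4 → Fin 4 → K
  embM g i j = blk (half i) (half j) (low i) (low j)
    where
    half : Fin 4 → Fin 2
    half zero = zero
    half (suc zero) = zero
    half (suc (suc _)) = suc zero
    low : Fin 4 → Fin 2
    low zero = zero
    low (suc zero) = suc zero
    low (suc (suc zero)) = zero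
    low (suc (suc (suc _))) = suc zero
    blk : Fin 2 → Fin 2 → Fin 2 → Fin 2 → K
    blk zero       zero       = embQ (ea g)
    blk zero       (suc zero) = embQ (eb g)
    blk (suc zero) zero       = embQ (ec g)
    blk (suc zero) (suc zero) = embQ (ed g)

  Poly : Set
  Poly = List K

  _+P_ : Poly → Poly → Poly
  [] +P q = q
  (a ∷ p) +P [] = a ∷ p
  (a ∷ p) +P (b ∷ q) = (a +K b) ∷ (p +P q)

  scaleP : K → Poly → Poly
  scaleP c [] = []
  scaleP c (a ∷ p) = (c *K a) ∷ scaleP c p

  _*P_ : Poly → Poly → Poly
  [] *P q = []
  (a ∷ p) *P q = scaleP a q +P (0K ∷ (p *P q))

  coeff : Poly → ℕ → K
  coeff [] _ = 0K
  coeff (a ∷ p) zero = a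
  coeff (a ∷ p) (suc k) = coeff p k

  det : ∀ n → (Fin n → Fin n → Poly) → Poly
  det zero M = 1K ∷ []
  det (suc n) M = go n (λ j → j) 1K
    where
    minor : Fin (suc n) → Fin n → Fin n → Poly
    minor j r c = M (suc r) (punchIn j c)
    term : Fin (suc n) → K → Poly
    term j sgn = scaleP sgn (M zero j *P det n (minor j))
    go : (k : ℕ) → (Fin (suc k) → Fin (suc n)) → K → Poly
    go zero f sgn = term (f zero) sgn
    go (suc k) f sgn = term (f zero) sgn +P go k (λ i → f (suc i)) (-K sgn)

  charPoly : ∀ n → (Fin n → Fin n → K) → Poly
  charPoly n M = det n (λ i j → entry i j (i ≟F j))
    where
    entry : (i j : Fin n) → Dec (i ≡ j) → Poly
    entry i j (yes _) = (-K M i j) ∷ 1K ∷ []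
    entry i j (no _)  = (-K M i j) ∷ []

  principalPoly : M2 → Poly
  principalPoly g = charPoly 4 (embM g)

  Φ₀ : M2 → Expr ℚ m
  Φ₀ h = q0ᴱ (ea h) ⊗ q0ᴱ (ed h) ⊖ Nrd (eb h)

  Φ₁ : M2 → M2 → Expr ℚ m
  Φ₁ (mat a b c d) h =
    ⊝ (Trd a ⊗ q0ᴱ (ed h) ⊕ Trd d ⊗ q0ᴱ (ea h) ⊖ Trd (ec h *Q conj c) ⊖ Trd (eb h *Q conj b))

  Φ₂ : M2 → M2 → Expr ℚ m
  Φ₂ (mat a b c d) h = Trd a ⊗ Trd d ⊖ Nrd (b +Q conj c) ⊕ (q0ᴱ (ea h) ⊕ q0ᴱ (ed h))

module Symbolic (k : ℕ) where
  open Reified {18 ℕ.+ k} (Ι (# 0)) (Ι (# 1)) public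

  gᴱ : M2
  gᴱ = mat (quatᴱ (Ι (# 2))  (Ι (# 3))  (Ι (# 4))  (Ι (# 5)))
           (quatᴱ (Ι (# 6))  (Ι (# 7))  (Ι (# 8))  (Ι (# 9)))
           (quatᴱ (Ι (# 10)) (Ι (# 11)) (Ι (# 12)) (Ι (# 13)))
           (quatᴱ (Ι (# 14)) (Ι (# 15)) (Ι (# 16)) (Ι (# 17)))

  hᴱ : M2
  hᴱ = gᴱ *M star gᴱ

module PrincipalPolynomial (α β : ℚ) where
  open QuatAlg α β

  Φ₀ : M2 → ℚ
  Φ₀ h = q0 (ea h) * q0 (ed h) - Nrd (eb h)

  Φ₁ : M2 → M2 → ℚ
  Φ₁ (mat a b c d) h =
    - (Trd a * q0 (ed h) + Trd d * q0 (ea h) - Trd (ec h *Q conj c) - Trd (eb h *Q conj b))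

  Φ₂ : M2 → M2 → ℚ
  Φ₂ (mat a b c d) h = Trd a * Trd d - Nrd (b +Q conj c) + (q0 (ea h) + q0 (ed h))

  Φ : M2 → M2 → List ℚ
  Φ g h = Φ₀ h ∷ Φ₁ g h ∷ Φ₂ g h ∷ - TrM g ∷ 1ℚ ∷ []

  env : ∀ {k} → M2 → Vec ℚ k → Vec ℚ (18 ℕ.+ k)
  env (mat a b c d) xs =
    α ∷ β ∷ q0 a ∷ q1 a ∷ q2 a ∷ q3 a ∷ q0 b ∷ q1 b ∷ q2 b ∷ q3 b
          ∷ q0 c ∷ q1 c ∷ q2 c ∷ q3 c ∷ q0 d ∷ q1 d ∷ q2 d ∷ q3 d ∷ xs

  principalPoly-≈Φ : ∀ g → principalPoly g ≈P ratPoly (Φ g (g *M star g))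
  principalPoly-≈Φ g = λ where
      0 → coefficient 0 (S.Φ₀ S.hᴱ) refl refl
      1 → coefficient 1 (S.Φ₁ S.gᴱ S.hᴱ) refl refl
      2 → coefficient 2 (S.Φ₂ S.gᴱ S.hᴱ) refl refl
      3 → coefficient 3 (⊝ S.TrM S.gᴱ) refl refl
      4 → coefficient 4 (Κ 1ℚ) refl refl
      (suc (suc (suc (suc (suc _))))) → refl
    where
    module S = Symbolic 0
    ρ = env g []
    coeffᴱ : ℕ → S.K
    coeffᴱ = S.coeff (S.principalPoly S.gᴱ)
    coefficient : ∀ k (cᴱ : Expr ℚ 18) →
      ⟦ proj₁ (coeffᴱ k) ⇓⟧ ρ ≡ ⟦ cᴱ ⇓⟧ ρ → ⟦ proj₂ (coeffᴱ k) ⇓⟧ ρ ≡ ⟦ Κ 0ℚ ⇓⟧ ρ →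
      (⟦ proj₁ (coeffᴱ k) ⟧ ρ , ⟦ proj₂ (coeffᴱ k) ⟧ ρ) ≡ ofℚ (⟦ cᴱ ⟧ ρ)
    coefficient k cᴱ re im =
      cong₂ _,_ (prove ρ (proj₁ (coeffᴱ k)) cᴱ re) (prove ρ (proj₂ (coeffᴱ k)) (Κ 0ℚ) im)

  Φ₂-via-traces : ∀ g → Φ₂ g (g *M star g) ≡ ½ * (TrM g * TrM g - TrM (g *M g))
  Φ₂-via-traces g = prove (env g []) (S.Φ₂ S.gᴱ S.hᴱ)
    (Κ ½ ⊗ (S.TrM S.gᴱ ⊗ S.TrM S.gᴱ S.⊖ S.TrM (S.gᴱ S.*M S.gᴱ))) refl
    where module S = Symbolic 0

  Φ-scalarM : ∀ g n →
    Φ g (scalarM n) ≡ n * n ∷ - (TrM g * n) ∷ Φ₂ g (scalarM n) ∷ - TrM g ∷ 1ℚ ∷ []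
  Φ-scalarM g n = cong₂ _∷_
    (prove ρ (S.Φ₀ (S.scalarM nᴱ)) (nᴱ ⊗ nᴱ) refl)
    (cong₂ _∷_ (prove ρ (S.Φ₁ S.gᴱ (S.scalarM nᴱ)) (⊝ (S.TrM S.gᴱ ⊗ nᴱ)) refl) refl)
    where
    module S = Symbolic 1
    ρ = env g (n ∷ [])
    nᴱ : Expr ℚ 19
    nᴱ = Ι (# 18)

  principalPoly-of-similitude : ∀ g n {c₂} → g *M star g ≡ scalarM n → Φ₂ g (scalarM n) ≡ c₂ →
    principalPoly g ≈P ratPoly (n * n ∷ - (TrM g * n) ∷ c₂ ∷ - TrM g ∷ 1ℚ ∷ [])
  principalPoly-of-similitude g n gg*≡n refl =
    subst (principalPoly g ≈P_) (cong ratPoly (Φ-scalarM g n))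
      (subst (λ h → principalPoly g ≈P ratPoly (Φ g h)) gg*≡n (principalPoly-≈Φ g))

lemma5p3 : (α β : ℚ) → α < 0ℚ → β < 0ℚ →
    let open QuatAlg α β in
    (a b c d : Quat) (n : ℚ) → 0ℚ < n →
    mat a b c d *M star (mat a b c d) ≡ scalarM n →
    (principalPoly (mat a b c d) ≈P
       ratPoly (n * n
               ∷ - ((Trd a + Trd d) * n)
               ∷ (Trd a * Trd d - Nrd (b +Q conj c) + (n + n))
               ∷ - (Trd a + Trd d)
               ∷ Data.Rational.1ℚ
               ∷ []))
    × (principalPoly (mat a b c d) ≈P
       ratPoly (n * n
               ∷ - (TrM (mat a b c d) * n)
               ∷ ½ * (TrM (mat a b c d) * TrM (mat a b c d)
                       - TrM (mat a b c d *M mat a b c d))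
               ∷ - TrM (mat a b c d)
               ∷ Data.Rational.1ℚ
               ∷ []))
lemma5p3 α β _ _ a b c d n _ gg*≡n =
    principalPoly-of-similitude g n gg*≡n refl
  , principalPoly-of-similitude g n gg*≡n (trans (cong (Φ₂ g) (sym gg*≡n)) (Φ₂-via-traces g))
  where
  open QuatAlg α β
  open PrincipalPolynomial α β
  g = mat a b c d
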